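{- Let $\mathcal{F}=\langle\mathbb{A},(\mu_i)_{i\in\mathsf{Ag}}\rangle$ be an APE-structure and $\mathbb{E}=(E,(\sim_i),(P_i),\Phi,\mathsf{pre})$ a probabilistic event structure over $\mathbb{A}$. Then the intermediate structure $\prod_{\mathbb{E}}\mathcal{F}=\langle\prod_{\mathbb{E}}\mathbb{A},(\mu'_i)_{i\in\mathsf{Ag}}\rangle$ is an ApPE-structure. Furthermore, if $y\in\prod_{\mathbb{E}}\mathbb{A}$ satisfies $\bigvee_{a\in\Phi}a\le y(e)$ for every $e\in E$, then $\mu'_i(x)=\mu'_i(x\wedge y)$ for every $x$ in the domain of $\mu'_i$.
   Context: Fix a set $\mathsf{Ag}$ of agents. A monadic Heyting algebra is $\langle\mathbb{L},(\lozenge_i),(\Box_i)\rangle$ with $\mathbb{L}$ a Heyting algebra and monotone unary $\lozenge_i,\Box_i$ such that for all $a,b$: $a\le\lozenge_ia$; $\Box_ia\le a$; $\lozenge_i(a\vee b)\le\lozenge_ia\vee\lozenge_ib$; $\Box_i(a\to b)\le\Box_ia\to\Box_ib$; $\lozenge_ia\le\Box_i\lozenge_ia$; $\lozenge_i\Box_ia\le\Box_ia$; $\Box_i(a\to b)\le\lozenge_ia\to\lozenge_ib$; $\lozenge_i\bot\le\bot$; $\top\le\Box_i\top$. An epistemic Heyting algebra is a finite monadic Heyting algebra with $\lozenge_ia\vee\neg\lozenge_ia=\top$. $a$ is $i$-minimal if $a\neq\bot$, $\lozenge_ia=a$, and $b<a$, $\lozenge_ib=b$ imply $b=\bot$; $\mathsf{Min}_i(\cdot)$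 denotes the set of these and $X{\downarrow}$ the downset of $X$. A partial $\mu:\mathbb{A}\to\mathbb{R}_{\ge0}$ is an $i$-premeasure if (1) its domain is $\mathsf{Min}_i(\mathbb{A}){\downarrow}$; (2) it is order-preserving; (3) for every $a\in\mathsf{Min}_i(\mathbb{A})$ and $b,c\le a$, $\mu(b\vee c)=\mu(b)+\mu(c)-\mu(b\wedge c)$; (4) $\mu(\bot)=0$ if the domain is nonempty. It is an $i$-measure if also (5) $b<c\le a\in\mathsf{Min}_i(\mathbb{A})$ implies $\mu(b)<\mu(c)$ and (6) $\mu(a)=1$ for $a\in\mathsf{Min}_i(\mathbb{A})$. An ApPE-structure (resp. APE-structure) is $\langle\mathbb{A},(\mu_i)\rangle$ with $\mathbb{A}$ an epistemic Heyting algebra and each $\mu_i$ an $i$-premeasure (resp. $i$-measure). A probabilistic event structure over $\mathbb{A}$ is $(E,(\sim_i),(P_i),\Phi,\mathsf{pre})$: $E$ nonempty finite; $\sim_i$ equivalence relations on $E$; $P_i:E\to(0,1]$ summing to 1 on each $\sim_i$-class; $\Phi$ a finite multiset of elements of $\mathbb{A}$ whose copies of a same element are linearly ordered by $\prec$, with members from distinct elements $a,b$ satisfying $a\wedge b=\bot$, $a<b$ or $b<a$; $\mathsf{pre}(\cdot\mid a)$ a probability distribution on $E$ for each member $a$; and $\mathsf{pre}(e\mid a)=0$ implies $\mathsf{pre}(e\mid b)=0$ whenever $a<b$ or $a\prec b$. $\prod_{\mathbb{E}}\mathbb{A}$ is the set of maps $f:E\to\mathbb{A}$ with pointwise Heyting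 operations, $(\lozenge'_if)(e)=\bigvee\{\lozenge_if(e')\mid e'\sim_ie\}$, $(\Box'_if)(e)=\bigwedge\{\Box_if(e')\mid e'\sim_ie\}$. For a member $a$ of $\Phi$, $\mathrm{mb}(a)$ is the set of maximal elements among the elements of $\mathbb{A}$ occurring in $\Phi$ strictly below $a$, and $\mu^a_i(x)=\mu_i(x\wedge a)-\sum_{b\in\mathrm{mb}(a)}\mu_i(x\wedge b)$ for $x$ in the domain of $\mu_i$. The map $\mu'_i$ has domain $\mathsf{Min}_i(\prod_{\mathbb{E}}\mathbb{A}){\downarrow}$ and is given by $\mu'_i(f)=\sum_{e\in E}\sum_{a\in\Phi}P_i(e)\cdot\mu^a_i(f(e))\cdot\mathsf{pre}(e\mid a)$ (the inner sum ranging over the members of $\Phi$). -}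

module Defs where

open import Level using (0ℓ)
open import Data.Nat using (ℕ; NonZero)
open import Data.Fin using (Fin) renaming (_<_ to _<ᶠ_)
open import Data.Fin.Properties using (all?; any?) renaming (_<?_ to _<ᶠ?_)
open import Data.List using (List; []; _∷_; foldr; filter; map; allFin)
open import Data.Product using (Σ; ∃; _×_; _,_)
open import Data.Sum using (_⊎_)
open import Relation.Nullary using (¬_; Dec)
open import Relation.Nullary.Decidable using (_×-dec_; ¬?)
open import Relation.Binary.Core using (Rel)
open import Relation.Binary.Definitions using (Decidable)
open import Relation.Binary.Structures using (IsDecTotalOrder; IsDecEquivalence)
open import Relation.Binary.PropositionalEquality using (_≡_)
open import Relation.Binary.Lattice.Structures using (IsHeytingAlgebra)
open import Algebra.Core using (Op₁; Op₂)
open import Algebra.Structures using (IsCommutativeRing)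

-- The real numbers, axiomatised as a (Dedekind-)complete ordered field.
-- All such fields are isomorphic to ℝ, so quantifying over them is the
-- same as working in ℝ.

record RealField : Set₁ where
  infixl 6 _+_ _-_
  infixl 7 _*_
  infix 4 _≤_ _<_
  field
    ℝ : Set
    _+_ _*_ : ℝ → ℝ → ℝ
    -_ : ℝ → ℝ
    0ℝ 1ℝ : ℝ
    _≤_ : ℝ → ℝ → Set
    isCommutativeRing : IsCommutativeRing _≡_ _+_ _*_ -_ 0ℝ 1ℝ
    0≢1 : ¬ (0ℝ ≡ 1ℝ)
    inverse : ∀ x → ¬ (x ≡ 0ℝ) → ∃ λ y → x * y ≡ 1ℝ
    isDecTotalOrder : IsDecTotalOrder _≡_ _≤_
    +-mono-≤ : ∀ {x y} z → x ≤ y → x + z ≤ y + z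
    *-nonneg : ∀ {x y} → 0ℝ ≤ x → 0ℝ ≤ y → 0ℝ ≤ x * y
    complete : (S : ℝ → Set) → ∃ S → (∃ λ b → ∀ x → S x → x ≤ b) →
               ∃ λ s → (∀ x → S x → x ≤ s) × (∀ b → (∀ x → S x → x ≤ b) → s ≤ b)

  _<_ : ℝ → ℝ → Set
  x < y = x ≤ y × ¬ (x ≡ y)

  _-_ : ℝ → ℝ → ℝ
  x - y = x + (- y)

  sumL : {A : Set} → List A → (A → ℝ) → ℝ
  sumL xs f = foldr (λ x r → f x + r) 0ℝ xs

-- Equality is a setoid equality _≈_; the
-- carrier comes with decision procedures for _≈_ and _≤_ (needed to
-- compute the finite sums/joins below; classically harmless).

record RawMHA (Ag : Set) : Set₁ where
  infix 4 _≈_ _≤_ _<_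
  infixr 6 _∨_
  infixr 7 _∧_
  infixr 5 _⇨_
  field
    Carrier : Set
    _≈_ _≤_ : Rel Carrier 0ℓ
    _≈?_ : Decidable _≈_
    _≤?_ : Decidable _≤_
    _∨_ _∧_ _⇨_ : Op₂ Carrier
    ⊤ ⊥ : Carrier
    ◇ □ : Ag → Op₁ Carrier

  _<_ : Rel Carrier 0ℓ
  x < y = x ≤ y × ¬ (x ≈ y)

  neg : Op₁ Carrier
  neg x = x ⇨ ⊥

  IsMin : Ag → Carrier → Set
  IsMin i a = ¬ (a ≈ ⊥) × (◇ i a ≈ a) × (∀ b → b < a → ◇ i b ≈ b → b ≈ ⊥)

  InDom : Ag → Carrier → Set
  InDom i x = ∃ λ a → IsMin i a × x ≤ a

Finite : {C : Set} → Rel C 0ℓ → Set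
Finite {C} _≈_ = Σ ℕ λ n → Σ (Fin n → C) λ en → ∀ c → ∃ λ k → en k ≈ c

module _ {Ag : Set} (M : RawMHA Ag) where
  open RawMHA M

  record IsMonadicHA : Set where
    field
      isHeytingAlgebra : IsHeytingAlgebra _≈_ _≤_ _∨_ _∧_ _⇨_ ⊤ ⊥
      ◇-mono : ∀ i {a b} → a ≤ b → ◇ i a ≤ ◇ i b
      □-mono : ∀ i {a b} → a ≤ b → □ i a ≤ □ i b
      ax1 : ∀ i a → a ≤ ◇ i a
      ax2 : ∀ i a → □ i a ≤ a
      ax3 : ∀ i a b → ◇ i (a ∨ b) ≤ ◇ i a ∨ ◇ i b
      ax4 : ∀ i a b → □ i (a ⇨ b) ≤ □ i a ⇨ □ i b
      ax5 : ∀ i a → ◇ i a ≤ □ i (◇ i a)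
      ax6 : ∀ i a → ◇ i (□ i a) ≤ □ i a
      ax7 : ∀ i a b → □ i (a ⇨ b) ≤ ◇ i a ⇨ ◇ i b
      ax8 : ∀ i → ◇ i ⊥ ≤ ⊥
      ax9 : ∀ i → ⊤ ≤ □ i ⊤

  record IsEpistemicHA : Set where
    field
      isMonadicHA : IsMonadicHA
      finite : Finite _≈_
      epistemic : ∀ i a → ◇ i a ∨ neg (◇ i a) ≈ ⊤

  module _ (R : RealField) where
    open RealField R renaming (_≤_ to _≤ℝ_; _<_ to _<ℝ_)

    -- A partial map with domain Min_i(A)↓ is represented by a total map
    -- μ : Carrier → ℝ of which only the values on InDom i matter.
    record IsPremeasure (i : Ag) (μ : Carrier → ℝ) : Set where
      field
        nonneg : ∀ x → InDom i x → 0ℝ ≤ℝ μ x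
        mono : ∀ x y → InDom i x → InDom i y → x ≤ y → μ x ≤ℝ μ y
        modular : ∀ a b c → IsMin i a → b ≤ a → c ≤ a →
                  μ (b ∨ c) ≡ μ b + μ c - μ (b ∧ c)
        bot : ∃ (InDom i) → μ ⊥ ≡ 0ℝ

    record IsMeasure (i : Ag) (μ : Carrier → ℝ) : Set where
      field
        isPremeasure : IsPremeasure i μ
        strict : ∀ a b c → IsMin i a → b < c → c ≤ a → μ b <ℝ μ c
        normalised : ∀ a → IsMin i a → μ a ≡ 1ℝ

    record IsApPE (μ : Ag → Carrier → ℝ) : Set where
      field
        isEpistemicHA : IsEpistemicHA
        isPremeasure : ∀ i → IsPremeasure i (μ i)

    record IsAPE (μ : Ag → Carrier → ℝ) : Set where
      field
        isEpistemicHA : IsEpistemicHA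
        isMeasure : ∀ i → IsMeasure i (μ i)

-- Probabilistic event structures over A.
-- E = Fin m; Φ is a multiset given by its members Fin k and the map φ
-- sending a member to the element of A it is a copy of.

record EventStructure {Ag : Set} (R : RealField) (M : RawMHA Ag) : Set₁ where
  open RealField R renaming (_≤_ to _≤ℝ_; _<_ to _<ℝ_)
  open RawMHA M
  field
    m : ℕ
    .{{m-nonZero}} : NonZero m
    _∼_ : Ag → Rel (Fin m) 0ℓ
    ∼-isDecEquivalence : ∀ i → IsDecEquivalence (_∼_ i)
  _∼?_ : ∀ i → Decidable (_∼_ i)
  _∼?_ i = IsDecEquivalence._≟_ (∼-isDecEquivalence i)
  field
    P : Ag → Fin m → ℝ
    P-pos : ∀ i e → 0ℝ <ℝ P i e
    P-≤1 : ∀ i e → P i e ≤ℝ 1ℝ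
    P-sum : ∀ i e → sumL (filter (λ e′ → _∼?_ i e′ e) (allFin m)) (P i) ≡ 1ℝ
    k : ℕ
    φ : Fin k → Carrier
    _≺_ : Rel (Fin k) 0ℓ
    ≺-copies : ∀ {p q} → p ≺ q → φ p ≈ φ q
    ≺-irrefl : ∀ p → ¬ (p ≺ p)
    ≺-trans : ∀ {p q r} → p ≺ q → q ≺ r → p ≺ r
    ≺-total : ∀ p q → φ p ≈ φ q → p ≡ q ⊎ p ≺ q ⊎ q ≺ p
    Φ-distinct : ∀ p q → ¬ (φ p ≈ φ q) → φ p ∧ φ q ≈ ⊥ ⊎ φ p < φ q ⊎ φ q < φ p
    pre : Fin k → Fin m → ℝ
    pre-nonneg : ∀ p e → 0ℝ ≤ℝ pre p e
    pre-sum : ∀ p → sumL (allFin m) (pre p) ≡ 1ℝ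
    pre-zero : ∀ p q e → (φ p < φ q ⊎ p ≺ q) → pre p e ≡ 0ℝ → pre q e ≡ 0ℝ

module _ {Ag : Set} {R : RealField} {M : RawMHA Ag} (𝔼 : EventStructure R M) where
  open RealField R renaming (_≤_ to _≤ℝ_; _<_ to _<ℝ_)
  open RawMHA M
  open EventStructure 𝔼

  ⋁ : List Carrier → Carrier
  ⋁ = foldr _∨_ ⊥

  ⋀ : List Carrier → Carrier
  ⋀ = foldr _∧_ ⊤

  class : Ag → Fin m → List (Fin m)
  class i e = filter (λ e′ → _∼?_ i e′ e) (allFin m)

  Prod : RawMHA Ag
  Prod = record
    { Carrier = Fin m → Carrier
    ; _≈_ = λ f g → ∀ e → f e ≈ g e
    ; _≤_ = λ f g → ∀ e → f e ≤ g e
    ; _≈?_ = λ f g → all? (λ e → f e ≈? g e)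
    ; _≤?_ = λ f g → all? (λ e → f e ≤? g e)
    ; _∨_ = λ f g e → f e ∨ g e
    ; _∧_ = λ f g e → f e ∧ g e
    ; _⇨_ = λ f g e → f e ⇨ g e
    ; ⊤ = λ _ → ⊤
    ; ⊥ = λ _ → ⊥
    ; ◇ = λ i f e → ⋁ (map (λ e′ → ◇ i (f e′)) (class i e))
    ; □ = λ i f e → ⋀ (map (λ e′ → □ i (f e′)) (class i e))
    }

  -- mb(p): the maximal elements of A occurring in Φ strictly below φ p,
  -- each represented once (by its copy with least index).
  private
    below? : ∀ p q → Dec (φ q < φ p)
    below? p q = (φ q ≤? φ p) ×-dec ¬? (φ q ≈? φ p)

    maximal? : ∀ p q → Dec (∀ r → ¬ (φ q < φ r × φ r < φ p))
    maximal? p q = all? (λ r → ¬? ((φ q <? φ r) ×-dec (φ r <? φ p)))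
      where
      _<?_ : ∀ x y → Dec (x < y)
      x <? y = (x ≤? y) ×-dec ¬? (x ≈? y)

    firstCopy? : ∀ q → Dec (∀ r → ¬ (φ r ≈ φ q × r <ᶠ q))
    firstCopy? q = all? (λ r → ¬? ((φ r ≈? φ q) ×-dec (r <ᶠ? q)))

  mb : Fin k → List (Fin k)
  mb p = filter (λ q → below? p q ×-dec (maximal? p q ×-dec firstCopy? q)) (allFin k)

  μᵃ : (μ : Carrier → ℝ) → Fin k → Carrier → ℝ
  μᵃ μ p x = μ (x ∧ φ p) - sumL (mb p) (λ q → μ (x ∧ φ q))

  μ′ : (μ : Ag → Carrier → ℝ) → Ag → (Fin m → Carrier) → ℝ
  μ′ μ i f = sumL (allFin m) (λ e → sumL (allFin k) (λ p → P i e * μᵃ (μ i) p (f e) * pre p e))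

  ⋁Φ : Carrier
  ⋁Φ = ⋁ (map φ (allFin k))

-- The product ∏_𝔼 A is a Heyting algebra pointwise, and ◇′ᵢ, □′ᵢ take the join and meet
-- of ◇ᵢ, □ᵢ over an ∼ᵢ-class, so each axiom of A lifts; finiteness and the epistemic law
-- lift as well. An i-minimal element a of the product lies, in each coordinate, below an
-- i-minimal element of A: meeting a with an atom c ≤ a e gives a nonzero ◇′ᵢ-fixed point
-- below a, which must be a. So the domain of μ′ᵢ is contained pointwise in that of μᵢ.
-- There, since mb(a) consists of pairwise disjoint elements below a, finite additivity of μᵢ
-- gives μᵃᵢ(x) = μᵢ(x ∧ a) − μᵢ(x ∧ ⋁mb(a)), a difference that modularity of μᵢ makes
-- nonnegative, monotone and modular; μ′ᵢ is a nonnegative combination of such terms.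
-- Finally μᵃᵢ(x) only depends on the meets x ∧ b with b ∈ Φ, which do not change when x
-- is replaced by x ∧ y for y ≥ ⋁Φ.

module Submission where

open import Defs
open import Data.Fin using (Fin)
open import Data.Product using (_×_; ∃; _,_; proj₁; proj₂)
open import Relation.Binary.PropositionalEquality as ≡
  using (_≡_; _≢_; refl; cong; cong₂; subst; subst₂; module ≡-Reasoning)

open import Level using (0ℓ)
open import Algebra.Bundles using (CommutativeRing)
import Algebra.Properties.Ring as RingProperties
import Algebra.Solver.CommutativeMonoid as CommutativeMonoidSolver
open import Data.Empty using (⊥-elim)
open import Data.Fin.Base using (funToFin; finToFun) renaming (_<_ to _<ᶠ_)
open import Data.Fin.Properties using (finToFun-funToFin; ¬∀⟶∃¬; <-cmp)
open import Data.List.Base using (List; []; _∷_; map; allFin)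
open import Data.List.Membership.Propositional using (_∈_)
open import Data.List.Membership.Propositional.Properties using (∈-allFin; ∈-filter⁺; ∈-filter⁻)
open import Data.List.Relation.Unary.Any using (here; there)
open import Data.List.Relation.Unary.All as All using (All; []; _∷_)
open import Data.List.Relation.Unary.All.Properties using (all-filter)
open import Data.List.Relation.Unary.AllPairs using (AllPairs; []; _∷_)
open import Data.List.Relation.Unary.Unique.Propositional using (Unique)
open import Data.List.Relation.Unary.Unique.Propositional.Properties using (allFin⁺; filter⁺)
open import Data.Nat.Base using (_^_)
open import Data.Sum using (inj₁; inj₂)
open import Function.Base using (_∘_)
open import Relation.Binary.Core using (Rel)
open import Relation.Binary.Definitions using (_Respects_; tri<; tri≈; tri>)
open import Relation.Binary.Structures using (IsDecTotalOrder; IsDecPartialOrder; IsDecEquivalence)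
import Relation.Binary.Construct.NonStrictToStrict as NonStrictToStrict
open import Relation.Binary.Lattice.Bundles using (HeytingAlgebra; DistributiveLattice)
open import Relation.Binary.Lattice.Structures using (IsHeytingAlgebra)
import Relation.Binary.Lattice.Properties.HeytingAlgebra as HeytingAlgebraProperties
import Relation.Binary.Lattice.Properties.MeetSemilattice as MeetSemilatticeProperties
import Relation.Binary.Lattice.Properties.JoinSemilattice as JoinSemilatticeProperties
import Relation.Binary.Lattice.Properties.DistributiveLattice as DistributiveLatticeProperties
open import Relation.Nullary using (¬_; yes; no)
open import Relation.Nullary.Decidable using (_×-dec_; ¬?; decidable-stable)
open import Relation.Unary using (Decidable)

module RealFieldProperties (R : RealField) where
  open RealField R renaming (_≤_ to _≤ℝ_)

  commutativeRing : CommutativeRing 0ℓ 0ℓ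
  commutativeRing = record { isCommutativeRing = isCommutativeRing }

  open CommutativeRing commutativeRing
    using (ring; +-commutativeMonoid; +-identityˡ; +-identityʳ; +-assoc; +-comm;
           -‿inverseˡ; -‿inverseʳ; distribˡ; distribʳ; zeroˡ; zeroʳ; *-comm)
  open RingProperties ring using (-0#≈0#; -‿+-comm; x[y-z]≈xy-xz; [y-z]x≈yx-zx)
  open CommutativeMonoidSolver +-commutativeMonoid using (solve; _⊜_; _⊕_)
  open IsDecTotalOrder isDecTotalOrder public using ()
    renaming (refl to ≤ℝ-refl; trans to ≤ℝ-trans; antisym to ≤ℝ-antisym)
  open ≡-Reasoning

  x-0≡x : ∀ x → x - 0ℝ ≡ x
  x-0≡x x = ≡.trans (cong (x +_) -0#≈0#) (+-identityʳ x)

  x-x≡0 : ∀ x → x - x ≡ 0ℝ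
  x-x≡0 = -‿inverseʳ

  -- b + c - d is the shape of the right-hand side of the modular law.

  modular-0 : 0ℝ + 0ℝ - 0ℝ ≡ 0ℝ
  modular-0 = ≡.trans (cong₂ _+_ (+-identityˡ 0ℝ) -0#≈0#) (+-identityˡ 0ℝ)

  modular-+ : ∀ b₁ c₁ d₁ b₂ c₂ d₂ →
              (b₁ + c₁ - d₁) + (b₂ + c₂ - d₂) ≡ (b₁ + b₂) + (c₁ + c₂) - (d₁ + d₂)
  modular-+ b₁ c₁ d₁ b₂ c₂ d₂ = begin
    (b₁ + c₁ + - d₁) + (b₂ + c₂ + - d₂)
      ≡⟨ solve 6 (λ b₁ c₁ d₁ b₂ c₂ d₂ → ((b₁ ⊕ c₁) ⊕ d₁) ⊕ ((b₂ ⊕ c₂) ⊕ d₂)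
                                      ⊜ ((b₁ ⊕ b₂) ⊕ (c₁ ⊕ c₂)) ⊕ (d₁ ⊕ d₂))
                 refl b₁ c₁ (- d₁) b₂ c₂ (- d₂) ⟩
    (b₁ + b₂) + (c₁ + c₂) + (- d₁ + - d₂)
      ≡⟨ cong ((b₁ + b₂) + (c₁ + c₂) +_) (-‿+-comm d₁ d₂) ⟩
    (b₁ + b₂) + (c₁ + c₂) - (d₁ + d₂) ∎

  modular-difference : ∀ b₁ c₁ d₁ b₂ c₂ d₂ →
              (b₁ + c₁ - d₁) - (b₂ + c₂ - d₂) ≡ (b₁ - b₂) + (c₁ - c₂) - (d₁ - d₂)
  modular-difference b₁ c₁ d₁ b₂ c₂ d₂ = begin
    (b₁ + c₁ - d₁) + - (b₂ + c₂ + - d₂)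
      ≡⟨ cong ((b₁ + c₁ - d₁) +_) (≡.sym (-‿+-comm (b₂ + c₂) (- d₂))) ⟩
    (b₁ + c₁ - d₁) + (- (b₂ + c₂) + - - d₂)
      ≡⟨ cong (λ z → (b₁ + c₁ - d₁) + (z + - - d₂)) (≡.sym (-‿+-comm b₂ c₂)) ⟩
    (b₁ + c₁ - d₁) + (- b₂ + - c₂ - - d₂)
      ≡⟨ modular-+ b₁ c₁ d₁ (- b₂) (- c₂) (- d₂) ⟩
    (b₁ - b₂) + (c₁ - c₂) - (d₁ - d₂) ∎

  modular-* : ∀ p u v w q → p * (u + v - w) * q ≡ p * u * q + p * v * q - p * w * q
  modular-* p u v w q = begin
    p * (u + v - w) * q             ≡⟨ cong (_* q) (x[y-z]≈xy-xz p (u + v) w) ⟩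
    (p * (u + v) - p * w) * q       ≡⟨ [y-z]x≈yx-zx q (p * (u + v)) (p * w) ⟩
    p * (u + v) * q - p * w * q     ≡⟨ cong (λ z → z * q - p * w * q) (distribˡ p u v) ⟩
    (p * u + p * v) * q - p * w * q ≡⟨ cong (_- p * w * q) (distribʳ q (p * u) (p * v)) ⟩
    p * u * q + p * v * q - p * w * q ∎

  x*0*y≡0 : ∀ x y → x * 0ℝ * y ≡ 0ℝ
  x*0*y≡0 x y = ≡.trans (cong (_* y) (zeroʳ x)) (zeroˡ y)

  +-monoʳ-≤ : ∀ {x y} z → x ≤ℝ y → z + x ≤ℝ z + y
  +-monoʳ-≤ {x} {y} z x≤y = subst₂ _≤ℝ_ (+-comm x z) (+-comm y z) (+-mono-≤ z x≤y)

  +-mono₂-≤ : ∀ {a b c d} → a ≤ℝ b → c ≤ℝ d → a + c ≤ℝ b + d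
  +-mono₂-≤ {b = b} {c} a≤b c≤d = ≤ℝ-trans (+-mono-≤ c a≤b) (+-monoʳ-≤ b c≤d)

  x≤y⇒0≤y-x : ∀ {x y} → x ≤ℝ y → 0ℝ ≤ℝ y - x
  x≤y⇒0≤y-x {x} {y} x≤y = subst (_≤ℝ y - x) (x-x≡0 x) (+-mono-≤ (- x) x≤y)

  0≤y-x⇒x≤y : ∀ {x y} → 0ℝ ≤ℝ y - x → x ≤ℝ y
  0≤y-x⇒x≤y {x} {y} 0≤y-x = subst₂ _≤ℝ_ (+-identityˡ x) y-x+x≡y (+-mono-≤ x 0≤y-x)
    where
    y-x+x≡y : y - x + x ≡ y
    y-x+x≡y = ≡.trans (+-assoc y (- x) x) (≡.trans (cong (y +_) (-‿inverseˡ x)) (+-identityʳ y))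

  *-monoˡ-≤ : ∀ {c x y} → 0ℝ ≤ℝ c → x ≤ℝ y → c * x ≤ℝ c * y
  *-monoˡ-≤ {c} {x} {y} 0≤c x≤y =
    0≤y-x⇒x≤y (subst (0ℝ ≤ℝ_) (x[y-z]≈xy-xz c y x) (*-nonneg 0≤c (x≤y⇒0≤y-x x≤y)))

  *-monoʳ-≤ : ∀ {c x y} → 0ℝ ≤ℝ c → x ≤ℝ y → x * c ≤ℝ y * c
  *-monoʳ-≤ {c} {x} {y} 0≤c x≤y = subst₂ _≤ℝ_ (*-comm c x) (*-comm c y) (*-monoˡ-≤ 0≤c x≤y)

  a+d-c≤b⇒a-c≤b-d : ∀ {a b c d} → a + d - c ≤ℝ b → a - c ≤ℝ b - d
  a+d-c≤b⇒a-c≤b-d {a} {b} {c} {d} h = subst (_≤ℝ b - d) a+d-c-d≡a-c (+-mono-≤ (- d) h)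
    where
    a+d-c-d≡a-c : a + d - c - d ≡ a - c
    a+d-c-d≡a-c = begin
      a + d + - c + - d   ≡⟨ solve 4 (λ a d c d′ → ((a ⊕ d) ⊕ c) ⊕ d′ ⊜ (a ⊕ c) ⊕ (d ⊕ d′))
                                 refl a d (- c) (- d) ⟩
      (a - c) + (d - d)   ≡⟨ cong ((a - c) +_) (x-x≡0 d) ⟩
      (a - c) + 0ℝ        ≡⟨ +-identityʳ (a - c) ⟩
      a - c ∎

  sumL-cong : ∀ {A : Set} (xs : List A) {f g : A → ℝ} → (∀ x → f x ≡ g x) → sumL xs f ≡ sumL xs g
  sumL-cong []       f≡g = refl
  sumL-cong (x ∷ xs) f≡g = cong₂ _+_ (f≡g x) (sumL-cong xs f≡g)

  sumL-zero : ∀ {A : Set} (xs : List A) {f : A → ℝ} → (∀ x → f x ≡ 0ℝ) → sumL xs f ≡ 0ℝ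
  sumL-zero []       f≡0 = refl
  sumL-zero (x ∷ xs) f≡0 = ≡.trans (cong₂ _+_ (f≡0 x) (sumL-zero xs f≡0)) (+-identityˡ 0ℝ)

  sumL-nonneg : ∀ {A : Set} (xs : List A) {f : A → ℝ} → (∀ x → 0ℝ ≤ℝ f x) → 0ℝ ≤ℝ sumL xs f
  sumL-nonneg []       0≤f = ≤ℝ-refl
  sumL-nonneg (x ∷ xs) {f} 0≤f =
    subst (_≤ℝ f x + sumL xs f) (+-identityˡ 0ℝ) (+-mono₂-≤ (0≤f x) (sumL-nonneg xs 0≤f))

  sumL-mono : ∀ {A : Set} (xs : List A) {f g : A → ℝ} → (∀ x → f x ≤ℝ g x) → sumL xs f ≤ℝ sumL xs g
  sumL-mono []       f≤g = ≤ℝ-refl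
  sumL-mono (x ∷ xs) f≤g = +-mono₂-≤ (f≤g x) (sumL-mono xs f≤g)

  sumL-modular : ∀ {A : Set} (xs : List A) {f g h l : A → ℝ} →
                 (∀ x → f x ≡ g x + h x - l x) →
                 sumL xs f ≡ sumL xs g + sumL xs h - sumL xs l
  sumL-modular []       eq = ≡.sym modular-0
  sumL-modular (x ∷ xs) {g = g} {h} {l} eq =
    ≡.trans (cong₂ _+_ (eq x) (sumL-modular xs eq)) (modular-+ (g x) (h x) (l x) _ _ _)

Finite-→ : ∀ {C : Set} {_≈_ : Rel C 0ℓ} m → Finite _≈_ →
           Finite {Fin m → C} (λ f g → ∀ e → f e ≈ g e)
Finite-→ {_≈_ = _≈_} m (n , enum , enum-onto) =
  n ^ m , (λ j e → enum (finToFun j e)) , λ f → funToFin (index ∘ f) , λ e →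
    subst (λ j → enum j ≈ f e) (≡.sym (finToFun-funToFin (index ∘ f) e)) (proj₂ (enum-onto (f e)))
  where
  index = λ c → proj₁ (enum-onto c)

module _ {C : Set} {_≈_ _≤_ : Rel C 0ℓ} (isDecPartialOrder : IsDecPartialOrder _≈_ _≤_) where
  open IsDecPartialOrder isDecPartialOrder
    renaming (refl to ≤-refl; trans to ≤-trans; antisym to ≤-antisym)
  open NonStrictToStrict _≈_ _≤_ using (_<_; <-irrefl; <-≤-trans; <-resp-≈; <-decidable)

  -- A single pass over an enumeration suffices: the candidate only decreases, so an
  -- element rejected earlier can never lie strictly below the final candidate.
  ∃-minimal-below : Finite _≈_ → {P : C → Set} → Decidable P → P Respects _≈_ →
                    ∀ {c} → P c → ∃ λ a → P a × a ≤ c × (∀ {b} → P b → ¬ b < a)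
  ∃-minimal-below (n , enum , enum-onto) {P} P? P-resp pc =
    let a , pa , a≤c , minimal = descend (allFin n) pc
    in a , pa , a≤c , λ {b} pb b<a →
      let j , enum-j≈b = enum-onto b
      in All.lookup minimal (∈-allFin j) (P-resp (Eq.sym enum-j≈b) pb)
                    (proj₂ (<-resp-≈ isEquivalence ≤-resp-≈) (Eq.sym enum-j≈b) b<a)
    where
    <-≤-trans′ = <-≤-trans Eq.sym ≤-trans ≤-antisym ≤-respʳ-≈

    descend : (js : List (Fin n)) → ∀ {c} → P c →
              ∃ λ a → P a × a ≤ c × All (λ j → P (enum j) → ¬ enum j < a) js
    descend []       {c} pc = c , pc , ≤-refl , []
    descend (j ∷ js) {c} pc with P? (enum j) ×-dec <-decidable _≟_ _≤?_ (enum j) c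
    ... | yes (pj , j<c) =
      let a , pa , a≤j , rest = descend js pj
      in a , pa , ≤-trans a≤j (proj₁ j<c) , (λ _ j<a → <-irrefl Eq.refl (<-≤-trans′ j<a a≤j)) ∷ rest
    ... | no ¬pj×j<c =
      let a , pa , a≤c , rest = descend js pc
      in a , pa , a≤c , (λ pj j<a → ¬pj×j<c (pj , <-≤-trans′ j<a a≤c)) ∷ rest

Unique⇒AllPairs : ∀ {A : Set} {P : A → Set} {R : Rel A 0ℓ} →
                  (∀ {x y} → P x → P y → x ≢ y → R x y) →
                  ∀ {xs} → All P xs → Unique xs → AllPairs R xs
Unique⇒AllPairs R-if-≢ []         []           = []
Unique⇒AllPairs R-if-≢ (px ∷ pxs) (x≢xs ∷ uxs) =
  All.zipWith (λ (py , x≢y) → R-if-≢ px py x≢y) (pxs , x≢xs) ∷ Unique⇒AllPairs R-if-≢ pxs uxs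

module MonadicHAProperties {Ag : Set} {M : RawMHA Ag} (isMonadicHA : IsMonadicHA M) where
  open RawMHA M
  open IsMonadicHA isMonadicHA

  heytingAlgebra : HeytingAlgebra 0ℓ 0ℓ 0ℓ
  heytingAlgebra = record { isHeytingAlgebra = isHeytingAlgebra }

  open HeytingAlgebra heytingAlgebra public
    using (module Eq; isPartialOrder; isEquivalence; x≤x∨y; y≤x∨y; ∨-least; x∧y≤x; x∧y≤y;
           ∧-greatest; transpose-⇨; transpose-∧; minimum; maximum)
    renaming (refl to ≤-refl; reflexive to ≤-reflexive; trans to ≤-trans; antisym to ≤-antisym)
  open HeytingAlgebraProperties heytingAlgebra public using (⇨ˡ-contravariant; distributiveLattice)
  open MeetSemilatticeProperties (HeytingAlgebra.meetSemilattice heytingAlgebra) public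
    using (∧-monotonic)
  open JoinSemilatticeProperties (HeytingAlgebra.joinSemilattice heytingAlgebra) public
    using (∨-monotonic)
  open DistributiveLattice distributiveLattice public using (∧-distribˡ-∨)
  open DistributiveLatticeProperties distributiveLattice public using (∧-distribʳ-∨)

  x≤⊥⇒x≈⊥ : ∀ {x} → x ≤ ⊥ → x ≈ ⊥
  x≤⊥⇒x≈⊥ x≤⊥ = ≤-antisym x≤⊥ (minimum _)

  ∧-comm-≤ : ∀ x y → x ∧ y ≤ y ∧ x
  ∧-comm-≤ x y = ∧-greatest (x∧y≤y x y) (x∧y≤x x y)

  ∧-distribʳ-∧ : ∀ x y z → (y ∧ z) ∧ x ≈ (y ∧ x) ∧ (z ∧ x)
  ∧-distribʳ-∧ x y z = ≤-antisym
    (∧-greatest (∧-monotonic (x∧y≤x y z) ≤-refl) (∧-monotonic (x∧y≤y y z) ≤-refl))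
    (∧-greatest (∧-monotonic (x∧y≤x y x) (x∧y≤x z x)) (≤-trans (x∧y≤y _ _) (x∧y≤y z x)))

  z≤y⇒x∧z≈[x∧y]∧z : ∀ {x y z} → z ≤ y → x ∧ z ≈ (x ∧ y) ∧ z
  z≤y⇒x∧z≈[x∧y]∧z {x} {y} {z} z≤y = ≤-antisym
    (∧-greatest (∧-greatest (x∧y≤x x z) (≤-trans (x∧y≤y x z) z≤y)) (x∧y≤y x z))
    (∧-monotonic (x∧y≤x x y) ≤-refl)

  ◇-cong : ∀ i {a b} → a ≈ b → ◇ i a ≈ ◇ i b
  ◇-cong i a≈b = ≤-antisym (◇-mono i (≤-reflexive a≈b)) (◇-mono i (≤-reflexive (Eq.sym a≈b)))

  ◇-idempotent : ∀ i a → ◇ i (◇ i a) ≤ ◇ i a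
  ◇-idempotent i a = ≤-trans (◇-mono i (ax5 i a)) (≤-trans (ax6 i (◇ i a)) (ax2 i (◇ i a)))

  ◇-closed⇒□-closed : ∀ i {c} → ◇ i c ≤ c → c ≤ □ i c
  ◇-closed⇒□-closed i {c} ◇c≤c = ≤-trans (ax1 i c) (≤-trans (ax5 i c) (□-mono i ◇c≤c))

  ◇-∧-□-⇨ : ∀ i a b → ◇ i a ∧ □ i (a ⇨ b) ≤ ◇ i b
  ◇-∧-□-⇨ i a b = ≤-trans (∧-comm-≤ _ _) (transpose-∧ (ax7 i a b))

  InDom-≤ : ∀ {i x y} → InDom i x → y ≤ x → InDom i y
  InDom-≤ (a , a-min , x≤a) y≤x = a , a-min , ≤-trans y≤x x≤a

  ∃-IsMin-below : Finite _≈_ → ∀ i {c} → ◇ i c ≈ c → ¬ c ≈ ⊥ → ∃ λ a → IsMin i a × a ≤ c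
  ∃-IsMin-below finite i ◇c≈c c≉⊥ =
    let a , (◇a≈a , a≉⊥) , a≤c , minimal =
          ∃-minimal-below isDecPartialOrder finite P? P-resp (◇c≈c , c≉⊥)
    in a , (a≉⊥ , ◇a≈a , λ b b<a ◇b≈b →
              decidable-stable (b ≈? ⊥) λ b≉⊥ → minimal (◇b≈b , b≉⊥) b<a) , a≤c
    where
    isDecPartialOrder : IsDecPartialOrder _≈_ _≤_
    isDecPartialOrder = record { isPartialOrder = isPartialOrder ; _≟_ = _≈?_ ; _≤?_ = _≤?_ }

    P : Carrier → Set
    P c = ◇ i c ≈ c × ¬ c ≈ ⊥

    P? : Decidable P
    P? c = (◇ i c ≈? c) ×-dec ¬? (c ≈? ⊥)

    P-resp : P Respects _≈_
    P-resp x≈y (◇x≈x , x≉⊥) =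
      Eq.trans (◇-cong i (Eq.sym x≈y)) (Eq.trans ◇x≈x x≈y) , λ y≈⊥ → x≉⊥ (Eq.trans x≈y y≈⊥)

module Product {Ag : Set} {R : RealField} {M : RawMHA Ag} (𝔼 : EventStructure R M)
               (isMonadicHA : IsMonadicHA M) where
  open RawMHA M
  open EventStructure 𝔼 using (m; _∼_; _∼?_; ∼-isDecEquivalence)
  open IsMonadicHA isMonadicHA
  open MonadicHAProperties isMonadicHA
  private
    module Π = RawMHA (Prod 𝔼)
    module ∼ (i : Ag) = IsDecEquivalence (∼-isDecEquivalence i)

  ⋁-upper : ∀ {A : Set} (g : A → Carrier) {xs x} → x ∈ xs → g x ≤ ⋁ 𝔼 (map g xs)
  ⋁-upper g (here refl)  = x≤x∨y _ _
  ⋁-upper g (there x∈xs) = ≤-trans (⋁-upper g x∈xs) (y≤x∨y _ _)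

  ⋁-least : ∀ {A : Set} (g : A → Carrier) xs {z} → (∀ {x} → x ∈ xs → g x ≤ z) → ⋁ 𝔼 (map g xs) ≤ z
  ⋁-least g []       g≤z = minimum _
  ⋁-least g (x ∷ xs) g≤z = ∨-least (g≤z (here refl)) (⋁-least g xs (g≤z ∘ there))

  ⋀-lower : ∀ {A : Set} (g : A → Carrier) {xs x} → x ∈ xs → ⋀ 𝔼 (map g xs) ≤ g x
  ⋀-lower g (here refl)  = x∧y≤x _ _
  ⋀-lower g (there x∈xs) = ≤-trans (x∧y≤y _ _) (⋀-lower g x∈xs)

  ⋀-greatest : ∀ {A : Set} (g : A → Carrier) xs {z} → (∀ {x} → x ∈ xs → z ≤ g x) → z ≤ ⋀ 𝔼 (map g xs)
  ⋀-greatest g []       z≤g = maximum _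
  ⋀-greatest g (x ∷ xs) z≤g = ∧-greatest (z≤g (here refl)) (⋀-greatest g xs (z≤g ∘ there))

  ∧-⋁-disjoint : ∀ {A : Set} (g : A → Carrier) {x} xs → All (λ y → g x ∧ g y ≈ ⊥) xs →
                 g x ∧ ⋁ 𝔼 (map g xs) ≤ ⊥
  ∧-⋁-disjoint g []       []                = x∧y≤y _ _
  ∧-⋁-disjoint g (y ∷ ys) (x∧y≈⊥ ∷ x∧ys≈⊥) =
    ≤-trans (≤-reflexive (∧-distribˡ-∨ _ _ _)) (∨-least (≤-reflexive x∧y≈⊥) (∧-⋁-disjoint g ys x∧ys≈⊥))

  ◇-⋁ : ∀ i {A : Set} (g : A → Carrier) xs → ◇ i (⋁ 𝔼 (map g xs)) ≤ ⋁ 𝔼 (map (◇ i ∘ g) xs)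
  ◇-⋁ i g []       = ax8 i
  ◇-⋁ i g (x ∷ xs) = ≤-trans (ax3 i _ _) (∨-monotonic ≤-refl (◇-⋁ i g xs))

  class-upper : ∀ {i e e′} (g : Fin m → Carrier) → _∼_ i e′ e → g e′ ≤ ⋁ 𝔼 (map g (class 𝔼 i e))
  class-upper {i} {e} {e′} g e′∼e = ⋁-upper g (∈-filter⁺ (λ x → _∼?_ i x e) (∈-allFin e′) e′∼e)

  class-least : ∀ {i e z} (g : Fin m → Carrier) → (∀ {e′} → _∼_ i e′ e → g e′ ≤ z) →
                ⋁ 𝔼 (map g (class 𝔼 i e)) ≤ z
  class-least {i} {e} g g≤z =
    ⋁-least g _ (λ e′∈ → g≤z (proj₂ (∈-filter⁻ (λ x → _∼?_ i x e) {xs = allFin m} e′∈)))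

  class-lower : ∀ {i e e′} (g : Fin m → Carrier) → _∼_ i e′ e → ⋀ 𝔼 (map g (class 𝔼 i e)) ≤ g e′
  class-lower {i} {e} {e′} g e′∼e = ⋀-lower g (∈-filter⁺ (λ x → _∼?_ i x e) (∈-allFin e′) e′∼e)

  class-greatest : ∀ {i e z} (g : Fin m → Carrier) → (∀ {e′} → _∼_ i e′ e → z ≤ g e′) →
                   z ≤ ⋀ 𝔼 (map g (class 𝔼 i e))
  class-greatest {i} {e} g z≤g =
    ⋀-greatest g _ (λ e′∈ → z≤g (proj₂ (∈-filter⁻ (λ x → _∼?_ i x e) {xs = allFin m} e′∈)))

  ◇′-closed : ∀ i f e → ◇ i (Π.◇ i f e) ≤ Π.◇ i f e
  ◇′-closed i f e = ≤-trans (◇-⋁ i (◇ i ∘ f) (class 𝔼 i e))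
    (class-least _ λ e′∼e → ≤-trans (◇-idempotent i (f _)) (class-upper (◇ i ∘ f) e′∼e))

  ◇′-resp-∼ : ∀ i f {e e″} → _∼_ i e e″ → Π.◇ i f e ≤ Π.◇ i f e″
  ◇′-resp-∼ i f e∼e″ = class-least _ λ e′∼e → class-upper (◇ i ∘ f) (∼.trans i e′∼e e∼e″)

  isHeytingAlgebra-Prod : IsHeytingAlgebra Π._≈_ Π._≤_ Π._∨_ Π._∧_ Π._⇨_ Π.⊤ Π.⊥
  isHeytingAlgebra-Prod = record
    { isBoundedLattice = record
      { isLattice = record
        { isPartialOrder = record
          { isPreorder = record
            { isEquivalence = record
              { refl  = λ _ → Eq.refl
              ; sym   = λ f≈g e → Eq.sym (f≈g e)
              ; trans = λ f≈g g≈h e → Eq.trans (f≈g e) (g≈h e)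
              }
            ; reflexive = λ f≈g e → ≤-reflexive (f≈g e)
            ; trans     = λ f≤g g≤h e → ≤-trans (f≤g e) (g≤h e)
            }
          ; antisym = λ f≤g g≤f e → ≤-antisym (f≤g e) (g≤f e)
          }
        ; supremum = λ f g → (λ e → x≤x∨y (f e) (g e)) , (λ e → y≤x∨y (f e) (g e)) ,
                             λ h f≤h g≤h e → ∨-least (f≤h e) (g≤h e)
        ; infimum  = λ f g → (λ e → x∧y≤x (f e) (g e)) , (λ e → x∧y≤y (f e) (g e)) ,
                             λ h h≤f h≤g e → ∧-greatest (h≤f e) (h≤g e)
        }
      ; maximum = λ f e → maximum (f e)
      ; minimum = λ f e → minimum (f e)
      }
    ; exponential = λ f g h → (λ f∧g≤h e → transpose-⇨ (f∧g≤h e)) , (λ f≤g⇨h e → transpose-∧ (f≤g⇨h e))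
    }

  □′-⇨ : ∀ i f g → Π.□ i (Π._⇨_ f g) Π.≤ Π._⇨_ (Π.□ i f) (Π.□ i g)
  □′-⇨ i f g e = transpose-⇨ (class-greatest _ λ e′∼e →
    ≤-trans (∧-monotonic (class-lower _ e′∼e) (class-lower _ e′∼e)) (transpose-∧ (ax4 i (f _) (g _))))

  ◇′≤□′◇′ : ∀ i f → Π.◇ i f Π.≤ Π.□ i (Π.◇ i f)
  ◇′≤□′◇′ i f e = class-greatest _ λ e″∼e →
    ≤-trans (◇′-resp-∼ i f (∼.sym i e″∼e)) (◇-closed⇒□-closed i (◇′-closed i f _))

  ◇′□′≤□′ : ∀ i f → Π.◇ i (Π.□ i f) Π.≤ Π.□ i f
  ◇′□′≤□′ i f e = class-least _ λ e′∼e → class-greatest _ λ e″∼e →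
    ≤-trans (◇-mono i (class-lower _ (∼.trans i e″∼e (∼.sym i e′∼e)))) (ax6 i (f _))

  □′-⇨-◇′ : ∀ i f g → Π.□ i (Π._⇨_ f g) Π.≤ Π._⇨_ (Π.◇ i f) (Π.◇ i g)
  □′-⇨-◇′ i f g e = transpose-⇨ (≤-trans (∧-comm-≤ _ _) (transpose-∧ (class-least _ λ e′∼e →
    transpose-⇨ (≤-trans (∧-monotonic ≤-refl (class-lower _ e′∼e))
                         (≤-trans (◇-∧-□-⇨ i (f _) (g _)) (class-upper (◇ i ∘ g) e′∼e))))))

  isMonadicHA-Prod : IsMonadicHA (Prod 𝔼)
  isMonadicHA-Prod = record
    { isHeytingAlgebra = isHeytingAlgebra-Prod
    ; ◇-mono = λ i f≤g e → class-least _ λ e′∼e → ≤-trans (◇-mono i (f≤g _)) (class-upper _ e′∼e)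
    ; □-mono = λ i f≤g e → class-greatest _ λ e′∼e → ≤-trans (class-lower _ e′∼e) (□-mono i (f≤g _))
    ; ax1 = λ i f e → ≤-trans (ax1 i (f e)) (class-upper (◇ i ∘ f) (∼.refl i))
    ; ax2 = λ i f e → ≤-trans (class-lower (□ i ∘ f) (∼.refl i)) (ax2 i (f e))
    ; ax3 = λ i f g e → class-least _ λ e′∼e →
              ≤-trans (ax3 i _ _) (∨-monotonic (class-upper (◇ i ∘ f) e′∼e) (class-upper (◇ i ∘ g) e′∼e))
    ; ax4 = □′-⇨
    ; ax5 = ◇′≤□′◇′
    ; ax6 = ◇′□′≤□′
    ; ax7 = □′-⇨-◇′
    ; ax8 = λ i e → class-least _ λ _ → ax8 i
    ; ax9 = λ i e → class-greatest _ λ _ → ax9 i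
    }

  isEpistemicHA-Prod : IsEpistemicHA M → IsEpistemicHA (Prod 𝔼)
  isEpistemicHA-Prod isEpistemicHA = record
    { isMonadicHA = isMonadicHA-Prod
    ; finite      = Finite-→ {_≈_ = _≈_} m finite
    ; epistemic   = λ i f e → ≤-antisym (maximum _)
        (≤-trans (≤-reflexive (Eq.sym (epistemic i (Π.◇ i f e))))
                 (∨-monotonic (◇′-closed i f e) (⇨ˡ-contravariant (ax1 i (Π.◇ i f e)))))
    }
    where open IsEpistemicHA isEpistemicHA using (finite; epistemic)

  module _ (finite : Finite _≈_) {i : Ag} {a : Fin m → Carrier} (a-min : Π.IsMin i a) where
    private
      a≉⊥        = proj₁ a-min
      ◇′a≈a      = proj₁ (proj₂ a-min)
      a-minimal  = proj₂ (proj₂ a-min)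

    ◇-fixed-component : ∀ e → ◇ i (a e) ≈ a e
    ◇-fixed-component e =
      ≤-antisym (≤-trans (class-upper (◇ i ∘ a) (∼.refl i)) (≤-reflexive (◇′a≈a e))) (ax1 i (a e))

    -- For an i-minimal c ≤ a e, the map a ∧ c is a nonzero ◇′-fixed point below a,
    -- so by minimality it is a itself.
    component-≤-IsMin : ∀ {e c} → IsMin i c → c ≤ a e → a e ≤ c
    component-≤-IsMin {e} {c} (c≉⊥ , ◇c≈c , _) c≤ae =
      ≤-trans (≤-reflexive (Eq.sym (a∧c≈a e))) (x∧y≤y _ _)
      where
      a∧c : Fin m → Carrier
      a∧c e′ = a e′ ∧ c

      ◇′a∧c≈a∧c : Π.◇ i a∧c Π.≈ a∧c
      ◇′a∧c≈a∧c e′ = ≤-antisym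
        (class-least _ λ e″∼e′ → ∧-greatest
          (≤-trans (◇-mono i (x∧y≤x _ _))
                   (≤-trans (class-upper (◇ i ∘ a) e″∼e′) (≤-reflexive (◇′a≈a e′))))
          (≤-trans (◇-mono i (x∧y≤y _ _)) (≤-reflexive ◇c≈c)))
        (IsMonadicHA.ax1 isMonadicHA-Prod i a∧c e′)

      a∧c≈a : a∧c Π.≈ a
      a∧c≈a = decidable-stable (a∧c Π.≈? a) λ a∧c≉a →
        c≉⊥ (x≤⊥⇒x≈⊥ (≤-trans (∧-greatest c≤ae ≤-refl)
                               (≤-reflexive (a-minimal a∧c ((λ _ → x∧y≤x _ _) , a∧c≉a) ◇′a∧c≈a∧c e))))

    IsMin-below-component : ∀ e → ¬ a e ≈ ⊥ → ∃ λ c → IsMin i c × c ≤ a e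
    IsMin-below-component e = ∃-IsMin-below finite i (◇-fixed-component e)

    IsMin-Prod⇒InDom : ∀ e → InDom i (a e)
    IsMin-Prod⇒InDom e with a e ≈? ⊥
    ... | yes ae≈⊥ =
      let e₀ , ae₀≉⊥ = ¬∀⟶∃¬ m _ (λ e → a e ≈? ⊥) a≉⊥
          c , c-min , _ = IsMin-below-component e₀ ae₀≉⊥
      in c , c-min , ≤-trans (≤-reflexive ae≈⊥) (minimum c)
    ... | no ae≉⊥ =
      let c , c-min , c≤ae = IsMin-below-component e ae≉⊥
      in c , c-min , component-≤-IsMin c-min c≤ae

  InDom-Prod⇒InDom : Finite _≈_ → ∀ {i x} → Π.InDom i x → ∀ e → InDom i (x e)
  InDom-Prod⇒InDom finite (a , a-min , x≤a) e = InDom-≤ (IsMin-Prod⇒InDom finite a-min e) (x≤a e)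

  open EventStructure 𝔼 using (k; φ; Φ-distinct)

  MaximalBelow : Fin k → Fin k → Set
  MaximalBelow p q = φ q < φ p × (∀ r → ¬ (φ q < φ r × φ r < φ p)) × (∀ r → ¬ (φ r ≈ φ q × r <ᶠ q))

  mb-MaximalBelow : ∀ p → All (MaximalBelow p) (mb 𝔼 p)
  mb-MaximalBelow p = all-filter _ (allFin k)

  MaximalBelow-disjoint : ∀ {p q q′} → MaximalBelow p q → MaximalBelow p q′ → q ≢ q′ →
                          φ q ∧ φ q′ ≈ ⊥
  MaximalBelow-disjoint {q = q} {q′} (q<p , q-max , q-first) (q′<p , q′-max , q′-first) q≢q′
    with φ q ≈? φ q′
  ... | yes φq≈φq′ with <-cmp q q′
  ...   | tri< q<q′ _ _ = ⊥-elim (q′-first q (φq≈φq′ , q<q′))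
  ...   | tri≈ _ q≡q′ _ = ⊥-elim (q≢q′ q≡q′)
  ...   | tri> _ _ q′<q = ⊥-elim (q-first q′ (Eq.sym φq≈φq′ , q′<q))
  MaximalBelow-disjoint {q = q} {q′} (q<p , q-max , _) (q′<p , q′-max , _) _
      | no φq≉φq′ with Φ-distinct q q′ φq≉φq′
  ... | inj₁ φq∧φq′≈⊥       = φq∧φq′≈⊥
  ... | inj₂ (inj₁ φq<φq′) = ⊥-elim (q-max q′ (φq<φq′ , q′<p))
  ... | inj₂ (inj₂ φq′<φq) = ⊥-elim (q′-max q (φq′<φq , q<p))

  mb-disjoint : ∀ p → AllPairs (λ q q′ → φ q ∧ φ q′ ≈ ⊥) (mb 𝔼 p)
  mb-disjoint p = Unique⇒AllPairs MaximalBelow-disjoint (mb-MaximalBelow p) (filter⁺ _ (allFin⁺ k))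

  ⋁mb : Fin k → Carrier
  ⋁mb p = ⋁ 𝔼 (map φ (mb 𝔼 p))

  ⋁mb≤φ : ∀ p → ⋁mb p ≤ φ p
  ⋁mb≤φ p = ⋁-least φ (mb 𝔼 p) λ q∈ → proj₁ (proj₁ (All.lookup (mb-MaximalBelow p) q∈))

module PremeasureProperties {Ag : Set} {R : RealField} {M : RawMHA Ag} (𝔼 : EventStructure R M)
         (isMonadicHA : IsMonadicHA M) {i : Ag} {ν : RawMHA.Carrier M → RealField.ℝ R}
         (ν-premeasure : IsPremeasure M R i ν) where
  open RealField R renaming (_≤_ to _≤ℝ_)
  open RealFieldProperties R
  open RawMHA M
  open MonadicHAProperties isMonadicHA
  open IsPremeasure ν-premeasure
  open EventStructure 𝔼 using (k; φ)
  open Product 𝔼 isMonadicHA using (∧-⋁-disjoint; mb-disjoint; ⋁mb; ⋁mb≤φ)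
  open ≡-Reasoning

  ν-cong : ∀ {x y} → InDom i x → x ≈ y → ν x ≡ ν y
  ν-cong x∈ x≈y =
    ≤ℝ-antisym (mono _ _ x∈ y∈ (≤-reflexive x≈y)) (mono _ _ y∈ x∈ (≤-reflexive (Eq.sym x≈y)))
    where y∈ = InDom-≤ x∈ (≤-reflexive (Eq.sym x≈y))

  ν-≈⊥ : ∀ {x} → InDom i x → x ≈ ⊥ → ν x ≡ 0ℝ
  ν-≈⊥ x∈ x≈⊥ = ≡.trans (ν-cong x∈ x≈⊥) (bot (_ , x∈))

  ν-∧-modular : ∀ {a b c} → IsMin i a → b ≤ a → c ≤ a → ∀ d →
                ν ((b ∨ c) ∧ d) ≡ ν (b ∧ d) + ν (c ∧ d) - ν ((b ∧ c) ∧ d)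
  ν-∧-modular {a} {b} {c} a-min b≤a c≤a d = begin
    ν ((b ∨ c) ∧ d)
      ≡⟨ ν-cong (a , a-min , ≤-trans (x∧y≤x _ _) (∨-least b≤a c≤a)) (∧-distribʳ-∨ d b c) ⟩
    ν ((b ∧ d) ∨ (c ∧ d))
      ≡⟨ modular a (b ∧ d) (c ∧ d) a-min (≤-trans (x∧y≤x b d) b≤a) (≤-trans (x∧y≤x c d) c≤a) ⟩
    ν (b ∧ d) + ν (c ∧ d) - ν ((b ∧ d) ∧ (c ∧ d))
      ≡⟨ cong (λ z → ν (b ∧ d) + ν (c ∧ d) - z) (ν-cong b∧d∧c∧d∈ (Eq.sym (∧-distribʳ-∧ d b c))) ⟩
    ν (b ∧ d) + ν (c ∧ d) - ν ((b ∧ c) ∧ d) ∎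
    where
    b∧d∧c∧d∈ : InDom i ((b ∧ d) ∧ (c ∧ d))
    b∧d∧c∧d∈ = a , a-min , ≤-trans (x∧y≤x _ _) (≤-trans (x∧y≤x b d) b≤a)

  sumL-ν-∧-disjoint : ∀ {A : Set} (g : A → Carrier) {x} → InDom i x →
                      ∀ {ys} → AllPairs (λ y y′ → g y ∧ g y′ ≈ ⊥) ys →
                      sumL ys (λ y → ν (x ∧ g y)) ≡ ν (x ∧ ⋁ 𝔼 (map g ys))
  sumL-ν-∧-disjoint g x∈ [] = ≡.sym (ν-≈⊥ (InDom-≤ x∈ (x∧y≤x _ _)) (x≤⊥⇒x≈⊥ (x∧y≤y _ _)))
  sumL-ν-∧-disjoint g {x} x∈@(a , a-min , x≤a) {y ∷ ys} (y-disjoint ∷ ys-disjoint) = begin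
    ν (x ∧ g y) + sumL ys (λ y → ν (x ∧ g y))
      ≡⟨ cong (ν (x ∧ g y) +_) (sumL-ν-∧-disjoint g x∈ ys-disjoint) ⟩
    ν (x ∧ g y) + ν (x ∧ G)
      ≡⟨ ≡.sym (x-0≡x _) ⟩
    ν (x ∧ g y) + ν (x ∧ G) - 0ℝ
      ≡⟨ cong (λ z → ν (x ∧ g y) + ν (x ∧ G) - z) (≡.sym (ν-≈⊥ overlap∈ (x≤⊥⇒x≈⊥ overlap≤⊥))) ⟩
    ν (x ∧ g y) + ν (x ∧ G) - ν ((x ∧ g y) ∧ (x ∧ G))
      ≡⟨ ≡.sym (modular a _ _ a-min (≤-trans (x∧y≤x _ _) x≤a) (≤-trans (x∧y≤x _ _) x≤a)) ⟩
    ν ((x ∧ g y) ∨ (x ∧ G))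
      ≡⟨ ν-cong (a , a-min , ∨-least (≤-trans (x∧y≤x _ _) x≤a) (≤-trans (x∧y≤x _ _) x≤a))
                (Eq.sym (∧-distribˡ-∨ x (g y) G)) ⟩
    ν (x ∧ (g y ∨ G)) ∎
    where
    G = ⋁ 𝔼 (map g ys)
    overlap∈ : InDom i ((x ∧ g y) ∧ (x ∧ G))
    overlap∈ = InDom-≤ x∈ (≤-trans (x∧y≤x _ _) (x∧y≤x _ _))
    overlap≤⊥ : (x ∧ g y) ∧ (x ∧ G) ≤ ⊥
    overlap≤⊥ = ≤-trans (∧-monotonic (x∧y≤y _ _) (x∧y≤y _ _)) (∧-⋁-disjoint g ys y-disjoint)

  ν-∧-difference-nonneg : ∀ {x A B} → InDom i x → B ≤ A → 0ℝ ≤ℝ ν (x ∧ A) - ν (x ∧ B)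
  ν-∧-difference-nonneg x∈ B≤A =
    x≤y⇒0≤y-x (mono _ _ (InDom-≤ x∈ (x∧y≤x _ _)) (InDom-≤ x∈ (x∧y≤x _ _)) (∧-monotonic ≤-refl B≤A))

  -- Modularity applied to x ∧ A and y ∧ B: their meet is x ∧ B, their join lies below y ∧ A.
  ν-∧-difference-mono : ∀ {x y A B} → InDom i y → B ≤ A → x ≤ y →
                        ν (x ∧ A) - ν (x ∧ B) ≤ℝ ν (y ∧ A) - ν (y ∧ B)
  ν-∧-difference-mono {x} {y} {A} {B} y∈@(a , a-min , y≤a) B≤A x≤y =
    a+d-c≤b⇒a-c≤b-d (subst (_≤ℝ ν (y ∧ A)) modularity (mono _ _ join∈ (InDom-≤ y∈ (x∧y≤x _ _)) join≤))
    where
    xA≤a  = ≤-trans (x∧y≤x x A) (≤-trans x≤y y≤a)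
    yB≤a  = ≤-trans (x∧y≤x y B) y≤a
    join∈ = a , a-min , ∨-least xA≤a yB≤a

    join≤ : (x ∧ A) ∨ (y ∧ B) ≤ y ∧ A
    join≤ = ∨-least (∧-monotonic x≤y ≤-refl) (∧-monotonic ≤-refl B≤A)

    meet≈ : (x ∧ A) ∧ (y ∧ B) ≈ x ∧ B
    meet≈ = ≤-antisym (∧-monotonic (x∧y≤x x A) (x∧y≤y y B))
                      (∧-greatest (∧-monotonic ≤-refl B≤A) (∧-monotonic x≤y ≤-refl))

    modularity : ν ((x ∧ A) ∨ (y ∧ B)) ≡ ν (x ∧ A) + ν (y ∧ B) - ν (x ∧ B)
    modularity = ≡.trans (modular a _ _ a-min xA≤a yB≤a)
      (cong (λ z → ν (x ∧ A) + ν (y ∧ B) - z) (ν-cong (a , a-min , ≤-trans (x∧y≤x _ _) xA≤a) meet≈))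

  μᵃ≡ : ∀ p {x} → InDom i x → μᵃ 𝔼 ν p x ≡ ν (x ∧ φ p) - ν (x ∧ ⋁mb p)
  μᵃ≡ p {x} x∈ = cong (λ z → ν (x ∧ φ p) - z) (sumL-ν-∧-disjoint φ x∈ (mb-disjoint p))

  μᵃ-nonneg : ∀ p {x} → InDom i x → 0ℝ ≤ℝ μᵃ 𝔼 ν p x
  μᵃ-nonneg p x∈ =
    subst (0ℝ ≤ℝ_) (≡.sym (μᵃ≡ p x∈)) (ν-∧-difference-nonneg x∈ (⋁mb≤φ p))

  μᵃ-mono : ∀ p {x y} → InDom i y → x ≤ y → μᵃ 𝔼 ν p x ≤ℝ μᵃ 𝔼 ν p y
  μᵃ-mono p y∈ x≤y = subst₂ _≤ℝ_ (≡.sym (μᵃ≡ p (InDom-≤ y∈ x≤y))) (≡.sym (μᵃ≡ p y∈))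
    (ν-∧-difference-mono y∈ (⋁mb≤φ p) x≤y)

  μᵃ-modular : ∀ p {a b c} → IsMin i a → b ≤ a → c ≤ a →
               μᵃ 𝔼 ν p (b ∨ c) ≡ μᵃ 𝔼 ν p b + μᵃ 𝔼 ν p c - μᵃ 𝔼 ν p (b ∧ c)
  μᵃ-modular p a-min b≤a c≤a = ≡.trans
    (cong₂ _-_ (ν-∧-modular a-min b≤a c≤a (φ p))
               (sumL-modular (mb 𝔼 p) (ν-∧-modular a-min b≤a c≤a ∘ φ)))
    (modular-difference _ _ _ _ _ _)

  μᵃ-⊥ : ∀ p → InDom i ⊥ → μᵃ 𝔼 ν p ⊥ ≡ 0ℝ
  μᵃ-⊥ p ⊥∈ = ≡.trans (cong₂ _-_ (ν-⊥∧ (φ p)) (sumL-zero (mb 𝔼 p) (ν-⊥∧ ∘ φ))) (x-x≡0 0ℝ)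
    where
    ν-⊥∧ : ∀ d → ν (⊥ ∧ d) ≡ 0ℝ
    ν-⊥∧ d = ν-≈⊥ (InDom-≤ ⊥∈ (x∧y≤x ⊥ d)) (x≤⊥⇒x≈⊥ (x∧y≤x ⊥ d))

  μᵃ-∧ : ∀ p {x z} → InDom i x → (∀ q → φ q ≤ z) → μᵃ 𝔼 ν p x ≡ μᵃ 𝔼 ν p (x ∧ z)
  μᵃ-∧ p {x} {z} x∈ φ≤z = cong₂ _-_ (ν-∧φ p) (sumL-cong (mb 𝔼 p) ν-∧φ)
    where
    ν-∧φ : ∀ q → ν (x ∧ φ q) ≡ ν ((x ∧ z) ∧ φ q)
    ν-∧φ q = ν-cong (InDom-≤ x∈ (x∧y≤x _ _)) (z≤y⇒x∧z≈[x∧y]∧z (φ≤z q))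

module ProductPremeasure {Ag : Set} {R : RealField} {M : RawMHA Ag} (𝔼 : EventStructure R M)
         (isEpistemicHA : IsEpistemicHA M) (μ : Ag → RawMHA.Carrier M → RealField.ℝ R)
         (i : Ag) (μᵢ-premeasure : IsPremeasure M R i (μ i)) where
  open RealField R renaming (_≤_ to _≤ℝ_)
  open RealFieldProperties R
  open RawMHA M
  open EventStructure 𝔼 using (m; k; φ; P; P-pos; pre; pre-nonneg)
  open IsEpistemicHA isEpistemicHA using (isMonadicHA; finite)
  open MonadicHAProperties isMonadicHA
  open Product 𝔼 isMonadicHA using (⋁-upper; IsMin-Prod⇒InDom; InDom-Prod⇒InDom)
  open PremeasureProperties 𝔼 isMonadicHA μᵢ-premeasure using (μᵃ-nonneg; μᵃ-mono; μᵃ-modular; μᵃ-⊥; μᵃ-∧)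
  private
    module Π = RawMHA (Prod 𝔼)

    component : ∀ {x} → Π.InDom i x → ∀ e → InDom i (x e)
    component = InDom-Prod⇒InDom finite

    0≤P : ∀ e → 0ℝ ≤ℝ P i e
    0≤P e = proj₁ (P-pos i e)

  IsPremeasure-μ′ : IsPremeasure (Prod 𝔼) R i (μ′ 𝔼 μ i)
  IsPremeasure-μ′ = record
    { nonneg  = λ x x∈ → sumL-nonneg (allFin m) λ e → sumL-nonneg (allFin k) λ p →
        *-nonneg (*-nonneg (0≤P e) (μᵃ-nonneg p (component x∈ e))) (pre-nonneg p e)
    ; mono    = λ x y x∈ y∈ x≤y → sumL-mono (allFin m) λ e → sumL-mono (allFin k) λ p →
        *-monoʳ-≤ (pre-nonneg p e) (*-monoˡ-≤ (0≤P e) (μᵃ-mono p (component y∈ e) (x≤y e)))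
    ; modular = λ a b c a-min b≤a c≤a → sumL-modular (allFin m) λ e → sumL-modular (allFin k) λ p →
        let a′ , a′-min , ae≤a′ = IsMin-Prod⇒InDom finite a-min e
        in ≡.trans (cong (λ z → P i e * z * pre p e)
                         (μᵃ-modular p a′-min (≤-trans (b≤a e) ae≤a′) (≤-trans (c≤a e) ae≤a′)))
                   (modular-* _ _ _ _ _)
    ; bot     = λ (x , x∈) → sumL-zero (allFin m) λ e → sumL-zero (allFin k) λ p →
        ≡.trans (cong (λ z → P i e * z * pre p e) (μᵃ-⊥ p (InDom-≤ (component x∈ e) (minimum _))))
                (x*0*y≡0 _ _)
    }

  μ′-∧-⋁Φ : (y : Fin m → Carrier) → (∀ e → ⋁Φ 𝔼 ≤ y e) →
            ∀ x → Π.InDom i x → μ′ 𝔼 μ i x ≡ μ′ 𝔼 μ i (x Π.∧ y)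
  μ′-∧-⋁Φ y ⋁Φ≤y x x∈ = sumL-cong (allFin m) λ e → sumL-cong (allFin k) λ p →
    cong (λ z → P i e * z * pre p e)
         (μᵃ-∧ p (component x∈ e) λ q → ≤-trans (⋁-upper φ (∈-allFin q)) (⋁Φ≤y e))

IsAPE⇒IsApPE : ∀ {Ag : Set} {M : RawMHA Ag} {R : RealField} {μ : Ag → RawMHA.Carrier M → RealField.ℝ R} →
               IsAPE M R μ → IsApPE M R μ
IsAPE⇒IsApPE isAPE = record
  { isEpistemicHA = isEpistemicHA
  ; isPremeasure  = IsMeasure.isPremeasure ∘ isMeasure
  }
  where open IsAPE isAPE

IsApPE-Prod : ∀ {Ag : Set} {R : RealField} {M : RawMHA Ag} {μ : Ag → RawMHA.Carrier M → RealField.ℝ R} →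
              (𝔼 : EventStructure R M) → IsApPE M R μ → IsApPE (Prod 𝔼) R (μ′ 𝔼 μ)
IsApPE-Prod {μ = μ} 𝔼 isApPE = record
  { isEpistemicHA = Product.isEpistemicHA-Prod 𝔼 (IsEpistemicHA.isMonadicHA isEpistemicHA) isEpistemicHA
  ; isPremeasure  = λ i → ProductPremeasure.IsPremeasure-μ′ 𝔼 isEpistemicHA μ i (isPremeasure i)
  }
  where open IsApPE isApPE

proposition6 : (Ag : Set) (R : RealField) (M : RawMHA Ag)
    (μ : Ag → RawMHA.Carrier M → RealField.ℝ R) →
    IsAPE M R μ →
    (𝔼 : EventStructure R M) →
    IsApPE (Prod 𝔼) R (μ′ 𝔼 μ)
    × ((y : Fin (EventStructure.m 𝔼) → RawMHA.Carrier M) →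
       (∀ e → RawMHA._≤_ M (⋁Φ 𝔼) (y e)) →
       ∀ i x → RawMHA.InDom (Prod 𝔼) i x →
       μ′ 𝔼 μ i x ≡ μ′ 𝔼 μ i (RawMHA._∧_ (Prod 𝔼) x y))
proposition6 Ag R M μ isAPE 𝔼 =
  IsApPE-Prod 𝔼 isApPE ,
  λ y ⋁Φ≤y i → ProductPremeasure.μ′-∧-⋁Φ 𝔼 isEpistemicHA μ i (isPremeasure i) y ⋁Φ≤y
  where
  isApPE = IsAPE⇒IsApPE isAPE
  open IsApPE isApPE
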